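{- Let $G$ and $H$ be finite, simple, undirected, connected graphs, where $G$ has the uni-ecc property and center $C_G$, and let $\varphi:V(G)\to V(H)$ be a surjective $(A,B,C)$-quasi-isometry. Then the center-shift of $\varphi$ satisfies \[ d_G\big(C_G,\varphi^{ -1}(C_H)\big)\le \left(A-\frac1A\right)\mathrm{rad}(H)+AB+\frac BA, \] where $C_H$ is the center of $H$.
   Context: Distances are shortest-path distances; for vertex sets $S_1,S_2$, $d(S_1,S_2)=\min\{d(v_1,v_2):v_1\in S_1,v_2\in S_2\}$, and $d(v,S)=\min_{x\in S}d(v,x)$. The eccentricity of $v$ is $\mathrm{ecc}(v)=\max_x d(v,x)$; the center of a graph is the set of vertices of minimum eccentricity; $\mathrm{rad}$ is the minimum eccentricity. A graph $G$ with center $C_G$ has the uni-ecc property if $d_G(C_G,v)=\mathrm{ecc}(v)-\mathrm{rad}(G)$ for all $v\in V(G)$. For non-negative integers $A,B,C$ with $A\ge1$, $f:V(G)\to V(H)$ is an $(A,B,C)$-quasi-isometry if for all $x,y$: $\frac1A d_G(x,y)-B\le d_H(f(x),f(y))\le A\,d_G(x,y)+B$, and for every $y\in V(H)$ there is $x$ with $d_H(y,f(x))\le C$. The center-shift of a surjective map $\varphi:G\to H$ is $d_G(C_G,\varphi^{ -1}(C_H))$. -}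

module Defs where

open import Data.Nat using (ℕ; zero; suc; _+_; _*_; _∸_; _≤_; _<_; _⊓_; _⊔_)
import Data.Nat as ℕ
open import Data.Bool using (Bool; true; false; _∧_; _∨_; if_then_else_)
open import Data.Fin using (Fin)
import Data.Fin as Fin
open import Data.List using (List; []; _∷_; map; foldr; filter; allFin; concatMap)
open import Data.Bool.ListAction using (any)
open import Data.Product using (∃-syntax; _×_)
open import Relation.Nullary.Decidable using (⌊_⌋)
open import Relation.Binary.PropositionalEquality using (_≡_)

record Graph : Set where
  field
    n      : ℕ
    adj    : Fin n → Fin n → Bool
    adj-sym     : ∀ x y → adj x y ≡ adj y x
    adj-irrefl  : ∀ x → adj x x ≡ false

open Graph public

V : Graph → Set
V G = Fin (n G)

reach : (G : Graph) → ℕ → V G → V G → Bool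
reach G zero    x y = ⌊ x Fin.≟ y ⌋
reach G (suc k) x y =
  reach G k x y ∨ any (λ z → reach G k x z ∧ adj G z y) (allFin (n G))

record Connected (G : Graph) : Set where
  field
    nonempty  : 0 < n G
    connected : ∀ (x y : V G) → ∃[ k ] (reach G k x y ≡ true)

-- Least k < fuel with p k = true (returns fuel if there is none).
firstTrue : (ℕ → Bool) → ℕ → ℕ
firstTrue p zero    = zero
firstTrue p (suc f) = if p zero then zero else suc (firstTrue (λ k → p (suc k)) f)

-- Shortest-path distance: least k such that a walk of length ≤ k exists.
-- (For connected graphs this is < n, so the fuel n suffices.)
dist : (G : Graph) → V G → V G → ℕ
dist G x y = firstTrue (λ k → reach G k x y) (n G)

-- Minimum / maximum of a list of naturals (minimum of [] is 0 by
-- convention; it is only used on nonempty lists).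
listMin : List ℕ → ℕ
listMin []       = 0
listMin (x ∷ xs) = foldr _⊓_ x xs

listMax : List ℕ → ℕ
listMax = foldr _⊔_ 0

distToSet : (G : Graph) → V G → List (V G) → ℕ
distToSet G v S = listMin (map (dist G v) S)

setDist : (G : Graph) → List (V G) → List (V G) → ℕ
setDist G S₁ S₂ = listMin (concatMap (λ a → map (dist G a) S₂) S₁)

ecc : (G : Graph) → V G → ℕ
ecc G v = listMax (map (dist G v) (allFin (n G)))

rad : Graph → ℕ
rad G = listMin (map (ecc G) (allFin (n G)))

center : (G : Graph) → List (V G)
center G = filter (λ v → ecc G v ℕ.≟ rad G) (allFin (n G))

UniEcc : Graph → Set
UniEcc G = ∀ (v : V G) → distToSet G v (center G) ≡ ecc G v ∸ rad G

-- (A,B,C)-quasi-isometry (A ≥ 1).  The lower bound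
--   (1/A) d_G(x,y) − B ≤ d_H(f x, f y)
-- is stated after multiplying by A > 0:  d_G(x,y) ≤ A d_H(f x,f y) + A B.
record QuasiIsometry (G H : Graph) (A B C : ℕ) (f : V G → V H) : Set where
  field
    A≥1   : 1 ≤ A
    lower : ∀ (x y : V G) → dist G x y ≤ A * dist H (f x) (f y) + A * B
    upper : ∀ (x y : V G) → dist H (f x) (f y) ≤ A * dist G x y + B
    dense : ∀ (y : V H) → ∃[ x ] (dist H y (f x) ≤ C)

Surjective : {X Y : Set} → (X → Y) → Set
Surjective {X} {Y} f = ∀ (y : Y) → ∃[ x ] (f x ≡ y)

preimageCenter : (G H : Graph) → (V G → V H) → List (V G)
preimageCenter G H φ =
  filter (λ v → ecc H (φ v) ℕ.≟ rad H) (allFin (n G))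

centerShift : (G H : Graph) → (V G → V H) → ℕ
centerShift G H φ = setDist G (center G) (preimageCenter G H φ)

-- Pick x with φ x central in H.  The lower quasi-isometry bound gives
-- ecc x ≤ A·rad H + A·B, while the upper bound applied to a central vertex of
-- G, together with surjectivity, gives rad H ≤ A·rad G + B.  By the uni-ecc
-- property the center-shift is at most d(x, C_G) = ecc x − rad G, and
-- eliminating rad G between the two estimates yields the bound.
module Submission where

open import Defs
open import Data.Nat using (ℕ; zero; suc; _+_; _*_; _∸_; _≤_; _<_; z≤n; s≤s)
import Data.Nat as ℕ
open import Data.Nat.Properties
open import Data.Nat.Solver using (module +-*-Solver)
open import Data.Bool using (Bool; true; false; T; if_then_else_)
open import Data.Bool.Properties using (T-∨; T-∧)
open import Data.Fin using (fromℕ<)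
open import Data.List using ([]; _∷_; map; allFin; concatMap)
open import Data.List.Properties using (foldr-preservesᵇ; foldr-preservesᵒ)
open import Data.List.Relation.Unary.All as All using (All)
open import Data.List.Relation.Unary.All.Properties using (map⁺)
open import Data.List.Relation.Unary.Any as Any using (Any; here; there; satisfied)
open import Data.List.Relation.Unary.Any.Properties using (any⁺; any⁻)
open import Data.List.Membership.Propositional using (_∈_; lose)
open import Data.List.Membership.Propositional.Properties
  using (∈-allFin; ∈-map⁺; ∈-map⁻; ∈-filter⁺; ∈-concatMap⁺; foldr-selective)
open import Data.Empty using (⊥-elim)
open import Data.Product using (∃-syntax; _×_; _,_)
open import Data.Sum using (_⊎_; inj₁; inj₂; [_,_])
open import Function using (_⇔_; Equivalence; mk⇔)
open import Relation.Nullary.Decidable using (toWitness; fromWitness)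
open import Relation.Binary.PropositionalEquality
  using (_≡_; refl; sym; trans; cong; subst)

open Equivalence using (to; from)

private
  variable
    X : Set

listMin-∈ : ∀ x xs → listMin (x ∷ xs) ∈ x ∷ xs
listMin-∈ x xs with foldr-selective ⊓-sel x xs
... | inj₁ eq = here eq
... | inj₂ p  = there p

listMin-≤ : ∀ {y} xs → y ∈ xs → listMin xs ≤ y
listMin-≤ {y} (x ∷ xs) y∈ =
  foldr-preservesᵒ (λ a b → [ ≤-trans (m⊓n≤m a b) , ≤-trans (m⊓n≤n a b) ]) x xs (bounded y∈)
  where
  bounded : y ∈ x ∷ xs → x ≤ y ⊎ Any (_≤ y) xs
  bounded (here refl) = inj₁ ≤-refl
  bounded (there p)   = inj₂ (Any.map (λ { refl → ≤-refl }) p)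

listMin-map-attained : ∀ (f : X → ℕ) {x xs} → x ∈ xs →
                       ∃[ y ] (y ∈ xs × listMin (map f xs) ≡ f y)
listMin-map-attained f {xs = x ∷ xs} _ = ∈-map⁻ f (listMin-∈ (f x) (map f xs))

listMax-≥ : ∀ {y} xs → y ∈ xs → y ≤ listMax xs
listMax-≥ xs y∈ = foldr-preservesᵒ
  (λ a b → [ (λ p → ≤-trans p (m≤m⊔n a b)) , (λ p → ≤-trans p (m≤n⊔m a b)) ]) 0 xs
  (inj₂ (Any.map (λ { refl → ≤-refl }) y∈))

listMax-≤ : ∀ {b} xs → All (_≤ b) xs → listMax xs ≤ b
listMax-≤ xs = foldr-preservesᵇ ⊔-lub z≤n

T-injective : ∀ {a b} → T a ⇔ T b → a ≡ b
T-injective {false} {false} _   = refl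
T-injective {false} {true}  a⇔b = ⊥-elim (from a⇔b _)
T-injective {true}  {false} a⇔b = ⊥-elim (to a⇔b _)
T-injective {true}  {true}  _   = refl

module _ (G : Graph) where

  data Walk : ℕ → V G → V G → Set where
    []  : ∀ {x} → Walk 0 x x
    _∷ʳ_ : ∀ {l x z y} → Walk l x z → T (adj G z y) → Walk (suc l) x y

  adj-symmetric : ∀ {x y} → T (adj G x y) → T (adj G y x)
  adj-symmetric {x} {y} = subst T (adj-sym G x y)

  Walk-cons : ∀ {l x z y} → T (adj G x z) → Walk l z y → Walk (suc l) x y
  Walk-cons xz []         = [] ∷ʳ xz
  Walk-cons xz (w ∷ʳ zy)  = Walk-cons xz w ∷ʳ zy

  Walk-reverse : ∀ {l x y} → Walk l x y → Walk l y x
  Walk-reverse []        = []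
  Walk-reverse (w ∷ʳ zy) = Walk-cons (adj-symmetric zy) (Walk-reverse w)

  reach-walk : ∀ k {x y} → T (reach G k x y) → ∃[ l ] (l ≤ k × Walk l x y)
  reach-walk zero    r with refl ← toWitness r = 0 , z≤n , []
  reach-walk (suc k) r with to T-∨ r
  ... | inj₁ r′ = let l , l≤k , w = reach-walk k r′ in l , m≤n⇒m≤1+n l≤k , w
  ... | inj₂ r′ =
    let z , xz∧zy = satisfied (any⁻ _ (allFin (n G)) r′)
        xz , zy   = to T-∧ xz∧zy
        l , l≤k , w = reach-walk k xz
    in suc l , s≤s l≤k , w ∷ʳ zy

  reach-refl : ∀ k x → T (reach G k x x)
  reach-refl zero    x = fromWitness refl
  reach-refl (suc k) x = from T-∨ (inj₁ (reach-refl k x))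

  walk-reach : ∀ {l k x y} → Walk l x y → l ≤ k → T (reach G k x y)
  walk-reach {k = k} [] _ = reach-refl k _
  walk-reach (_∷ʳ_ {z = z} w zy) (s≤s l≤k) =
    from T-∨ (inj₂ (any⁺ _ (lose (∈-allFin z) (from T-∧ (walk-reach w l≤k , zy)))))

  reach-sym : ∀ k x y → reach G k x y ≡ reach G k y x
  reach-sym k x y = T-injective (mk⇔ (reverse x y) (reverse y x))
    where
    reverse : ∀ x y → T (reach G k x y) → T (reach G k y x)
    reverse x y r = let l , l≤k , w = reach-walk k r in walk-reach (Walk-reverse w) l≤k

firstTrue-cong : ∀ {p q : ℕ → Bool} → (∀ k → p k ≡ q k) → ∀ f → firstTrue p f ≡ firstTrue q f
firstTrue-cong p≗q zero    = refl
firstTrue-cong {q = q} p≗q (suc f) rewrite p≗q 0 =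
  cong (λ t → if q 0 then 0 else suc t) (firstTrue-cong (λ k → p≗q (suc k)) f)

dist-sym : ∀ G x y → dist G x y ≡ dist G y x
dist-sym G x y = firstTrue-cong (λ k → reach-sym G k x y) (n G)

dist≤ecc : ∀ G x y → dist G x y ≤ ecc G x
dist≤ecc G x y = listMax-≥ _ (∈-map⁺ (dist G x) (∈-allFin y))

ecc-≤ : ∀ G x {b} → (∀ y → dist G x y ≤ b) → ecc G x ≤ b
ecc-≤ G x bound =
  listMax-≤ (map (dist G x) (allFin (n G))) (map⁺ (All.tabulate (λ {y} _ → bound y)))

rad≤ecc : ∀ G x → rad G ≤ ecc G x
rad≤ecc G x = listMin-≤ _ (∈-map⁺ (ecc G) (∈-allFin x))

rad-attained : ∀ G → 0 < n G → ∃[ c ] (ecc G c ≡ rad G)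
rad-attained G n>0 with listMin-map-attained (ecc G) (∈-allFin (fromℕ< n>0))
... | c , _ , eq = c , sym eq

setDist-≤-distToSet : ∀ G {x} S₁ {S₂} → x ∈ S₂ → setDist G S₁ S₂ ≤ distToSet G x S₁
setDist-≤-distToSet G []       x∈ = z≤n
setDist-≤-distToSet G {x} S₁@(_ ∷ _) {S₂} x∈
  with c , c∈ , eq ← listMin-map-attained (dist G x) {xs = S₁} (here refl) =
  begin
    setDist G S₁ S₂   ≤⟨ listMin-≤ _ cx∈ ⟩
    dist G c x        ≡⟨ dist-sym G c x ⟩
    dist G x c        ≡⟨ sym eq ⟩
    distToSet G x S₁  ∎
  where
  open ≤-Reasoning
  cx∈ : dist G c x ∈ concatMap (λ a → map (dist G a) S₂) S₁
  cx∈ = ∈-concatMap⁺ (λ a → map (dist G a) S₂) (lose c∈ (∈-map⁺ (dist G c) x∈))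

∈-preimageCenter : ∀ G H φ {x} → ecc H (φ x) ≡ rad H → x ∈ preimageCenter G H φ
∈-preimageCenter G H φ = ∈-filter⁺ (λ v → ecc H (φ v) ℕ.≟ rad H) (∈-allFin _)

centerShift-≤ : ∀ G H φ → UniEcc G → ∀ {x} → ecc H (φ x) ≡ rad H →
                centerShift G H φ ≤ ecc G x ∸ rad G
centerShift-≤ G H φ uni {x} φx-central = begin
  centerShift G H φ
    ≤⟨ setDist-≤-distToSet G (center G) (∈-preimageCenter G H φ φx-central) ⟩
  distToSet G x (center G)  ≡⟨ uni x ⟩
  ecc G x ∸ rad G           ∎
  where open ≤-Reasoning

ecc-image-≤ : ∀ G H (φ : V G → V H) A B → Surjective φ →
              (∀ x y → dist H (φ x) (φ y) ≤ A * dist G x y + B) →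
              ∀ x → ecc H (φ x) ≤ A * ecc G x + B
ecc-image-≤ G H φ A B surj upper x = ecc-≤ H (φ x) bound
  where
  bound : ∀ y → dist H (φ x) y ≤ A * ecc G x + B
  bound y with z , refl ← surj y =
    ≤-trans (upper x z) (+-monoˡ-≤ B (*-monoʳ-≤ A (dist≤ecc G x z)))

ecc-≤-image : ∀ G H (φ : V G → V H) A K →
              (∀ x y → dist G x y ≤ A * dist H (φ x) (φ y) + K) →
              ∀ x → ecc G x ≤ A * ecc H (φ x) + K
ecc-≤-image G H φ A K lower x = ecc-≤ G x λ y →
  ≤-trans (lower x y) (+-monoˡ-≤ K (*-monoʳ-≤ A (dist≤ecc H (φ x) (φ y))))

rad-≤-image : ∀ G H (φ : V G → V H) A B → 0 < n G → Surjective φ →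
              (∀ x y → dist H (φ x) (φ y) ≤ A * dist G x y + B) →
              rad H ≤ A * rad G + B
rad-≤-image G H φ A B n>0 surj upper
  with c , c-central ← rad-attained G n>0 = begin
  rad H              ≤⟨ rad≤ecc H (φ c) ⟩
  ecc H (φ c)        ≤⟨ ecc-image-≤ G H φ A B surj upper c ⟩
  A * ecc G c + B    ≡⟨ cong (λ e → A * e + B) c-central ⟩
  A * rad G + B      ∎
  where open ≤-Reasoning

shift-bound : ∀ {A B e r h} → 1 ≤ A → e ≤ A * h + A * B → h ≤ A * r + B →
              A * (e ∸ r) ≤ (A * A ∸ 1) * h + A * A * B + B
shift-bound {A} {B} {e} {r} {h} A≥1 e≤ h≤ = begin
  A * (e ∸ r)    ≡⟨ *-distribˡ-∸ A e r ⟩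
  A * e ∸ A * r  ≤⟨ m≤n+o⇒m∸n≤o (A * e) (A * r) Ae≤ ⟩
  P + A * A * B + B ∎
  where
  open ≤-Reasoning
  open +-*-Solver
  P = (A * A ∸ 1) * h

  AAh≡P+h : A * A * h ≡ P + h
  AAh≡P+h = begin-equality
    A * A * h            ≡⟨ cong (_* h) (sym (m∸n+n≡m (*-mono-≤ A≥1 A≥1))) ⟩
    (A * A ∸ 1 + 1) * h  ≡⟨ *-distribʳ-+ h (A * A ∸ 1) 1 ⟩
    P + 1 * h            ≡⟨ cong (P +_) (*-identityˡ h) ⟩
    P + h                ∎

  Ae≤ : A * e ≤ A * r + (P + A * A * B + B)
  Ae≤ = begin
    A * e                    ≤⟨ *-monoʳ-≤ A e≤ ⟩
    A * (A * h + A * B)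
      ≡⟨ solve 3 (λ a x b → a :* (a :* x :+ a :* b) := a :* a :* x :+ a :* a :* b) refl A h B ⟩
    A * A * h + A * A * B    ≡⟨ cong (_+ A * A * B) AAh≡P+h ⟩
    P + h + A * A * B        ≤⟨ +-monoˡ-≤ (A * A * B) (+-monoʳ-≤ P h≤) ⟩
    P + (A * r + B) + A * A * B
      ≡⟨ solve 4 (λ p ar b q → p :+ (ar :+ b) :+ q := ar :+ (p :+ q :+ b))
                 refl P (A * r) B (A * A * B) ⟩
    A * r + (P + A * A * B + B) ∎

theorem3 : (G H : Graph) → Connected G → Connected H → UniEcc G →
           (A B C : ℕ) (φ : V G → V H) → Surjective φ →
           QuasiIsometry G H A B C φ →
           A * centerShift G H φ ≤ (A * A ∸ 1) * rad H + A * A * B + B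
theorem3 G H cG cH uni A B C φ surj qi =
  let h , h-central = rad-attained H (Connected.nonempty cH)
      x , φx≡h      = surj h
      φx-central    = trans (cong (ecc H) φx≡h) h-central
      eccx≤         = subst (λ t → ecc G x ≤ A * t + A * B) φx-central
                            (ecc-≤-image G H φ A (A * B) lower x)
      radH≤         = rad-≤-image G H φ A B (Connected.nonempty cG) surj upper
  in ≤-trans (*-monoʳ-≤ A (centerShift-≤ G H φ uni φx-central))
             (shift-bound A≥1 eccx≤ radH≤)
  where open QuasiIsometry qi
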